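{- Let $N$ be a positive integer and let $t$ be such that $a_t\le N<a_{t+1}$. Then the $a$-Zeckendorf representation of $N$ has $t+1$ digits.
   Context: Fix nonnegative integers $\lambda_1,\lambda_2,\dots$ and an integer $k\ge1$ (the order) such that $\lambda_1\ge1$, $\lambda_k\ge1$, $\lambda_i=0$ for $i>k$, and $\lambda_1\ge2$ if $k=1$. Define $(a_n)_{n\in\mathbb Z}$ by $a_n=1$ for $n\le0$ and $a_n=\sum_{i=1}^k\lambda_ia_{n-i}$ for $n\ge1$. Let $\Lambda_j=\sum_{i=1}^j\lambda_i$, $\Lambda=\Lambda_k$, and for $0\le\ell<\Lambda$ let $\mu_\ell$ be the least $j$ with $\Lambda_j>\ell$. A digit sequence $d_M,\dots,d_0$ is $a$-valid if $0\le d_i<\Lambda$ for all $i$, $d_M\ne0$, and whenever $d_i=\ell$ with $i<M$ we have $d_{i+1}=\dots=d_{i+\mu_\ell-1}=0$. Order the set of $a$-valid sequences so that shorter sequences come before longer ones and sequences of equal length are ordered lexicographically (comparing $d_M$ first). The $a$-Zeckendorf representation of a positive integer $N$ is the $N$-th sequence in this order. -}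

module Defs where

open import Data.Nat using (ℕ; zero; suc; _+_; _*_; _∸_; _≤_; _<ᵇ_; _≡ᵇ_)
open import Data.Bool using (Bool; true; false; _∧_; if_then_else_; not)
open import Data.List using (List; []; _∷_; length; zipWith; map; concat;
  concatMap; upTo; replicate; reverse; take; drop; filterᵇ; last)
open import Data.Nat.ListAction using (sum)
open import Data.Bool.ListAction using (and)
open import Data.Maybe using (Maybe; just; nothing)
open import Data.Product using (Σ; _×_; ∃)
open import Relation.Binary.PropositionalEquality using (_≡_)

-- Coefficients λ₁,…,λ_k are given as the list  ls = [λ₁, …, λ_k]  (so k = length ls).

record Admissible (ls : List ℕ) : Set where
  field
    l₁       : ℕ
    rest     : List ℕ
    shape    : ls ≡ l₁ ∷ rest
    l₁≥1     : 1 ≤ l₁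
    lk≥1     : ∀ x → last ls ≡ just x → 1 ≤ x
    k1⇒l₁≥2  : rest ≡ [] → 2 ≤ l₁

dropLast : List ℕ → List ℕ
dropLast []           = []
dropLast (x ∷ [])     = []
dropLast (x ∷ y ∷ xs) = x ∷ dropLast (y ∷ xs)

-- hist ls n = [a_n, a_{n-1}, …, a_{n-k+1}]  (with a_m = 1 for m ≤ 0)
hist : List ℕ → ℕ → List ℕ
hist ls zero    = replicate (length ls) 1
hist ls (suc n) = sum (zipWith _*_ ls (hist ls n)) ∷ dropLast (hist ls n)

headOr1 : List ℕ → ℕ
headOr1 []      = 1
headOr1 (x ∷ _) = x

-- the recurrence sequence a_n for n ≥ 0:  a_0 = 1 (= a_m for m ≤ 0),
-- a_n = Σ_{i=1}^k λ_i a_{n-i} for n ≥ 1.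
seqA : List ℕ → ℕ → ℕ
seqA ls n = headOr1 (hist ls n)

bigΛ : List ℕ → ℕ
bigΛ ls = sum ls

-- μ_ℓ = least j ≥ 1 with Λ_j > ℓ  (for 0 ≤ ℓ < Λ)
muGo : ℕ → List ℕ → ℕ → ℕ → ℕ
muGo ℓ []       acc j = j
muGo ℓ (x ∷ xs) acc j = if ℓ <ᵇ (acc + x) then j else muGo ℓ xs (acc + x) (suc j)

mu : List ℕ → ℕ → ℕ
mu ls ℓ = muGo ℓ ls 0 1

-- Digit sequences are lists written most-significant digit first: [d_M, …, d_0].

allZero : List ℕ → Bool
allZero xs = and (map (λ d → d ≡ᵇ 0) xs)

-- condition on least-significant-first list [d_i, d_{i+1}, …, d_M]:
-- for each position i < M with d_i = ℓ, the digits d_{i+1},…,d_{i+μ_ℓ-1}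
-- (those that exist, i.e. index ≤ M) are 0.
blockOK : List ℕ → List ℕ → Bool
blockOK ls []       = true
blockOK ls (d ∷ []) = true
blockOK ls (d ∷ h ∷ hs) = allZero (take (mu ls d ∸ 1) (h ∷ hs)) ∧ blockOK ls (h ∷ hs)

digitsOK : List ℕ → List ℕ → Bool
digitsOK ls ds = and (map (λ d → d <ᵇ bigΛ ls) ds)

leadingNonzero : List ℕ → Bool
leadingNonzero []      = false
leadingNonzero (d ∷ _) = not (d ≡ᵇ 0)

validᵇ : List ℕ → List ℕ → Bool
validᵇ ls ds = leadingNonzero ds ∧ digitsOK ls ds ∧ blockOK ls (reverse ds)

words : ℕ → ℕ → List (List ℕ)
words b zero    = [] ∷ []
words b (suc L) = concatMap (λ d → map (d ∷_) (words b L)) (upTo b)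

validOfLength : List ℕ → ℕ → List (List ℕ)
validOfLength ls L = filterᵇ (validᵇ ls) (words (bigΛ ls) L)

-- initial segment of the order (shorter first, then lexicographic):
-- all a-valid sequences of length 1,…,n
validUpToLength : List ℕ → ℕ → List (List ℕ)
validUpToLength ls n = concatMap (λ L → validOfLength ls (suc L)) (upTo n)

nth : {A : Set} → ℕ → List A → Maybe A
nth n       []       = nothing
nth zero    (x ∷ xs) = just x
nth (suc n) (x ∷ xs) = nth n xs

-- ds is the N-th (1-indexed, N ≥ 1) a-valid sequence in the order,
-- i.e. the a-Zeckendorf representation of N.
IsZeckendorfRep : List ℕ → ℕ → List ℕ → Set
IsZeckendorfRep ls N ds = ∃ λ n → nth (N ∸ 1) (validUpToLength ls n) ≡ just ds

-- Call a digit string admissible if it satisfies the conditions of a-validity except d_M ≠ 0,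
-- i.e. leading zeros are allowed. Classify the admissible strings of length n + 1 by their last
-- digit d_0 = ℓ: it forces d_1 = … = d_{μ_ℓ-1} = 0, and what remains is an arbitrary admissible
-- string of length max(0, n - (μ_ℓ - 1)). Exactly λ_j digits ℓ have μ_ℓ = j, so the numbers of
-- admissible strings obey the recurrence of (a_n), starting from the single string of length 0;
-- hence there are a_n admissible strings of length n. Those with a nonzero leading digit are the
-- a-valid ones, so there are a_t - 1 valid strings of length at most t and a_{t+1} - a_t of length
-- t + 1: the N-th valid string, for a_t ≤ N < a_{t+1}, has t + 1 digits.
module Submission where

open import Defs
open import Algebra.Bundles using (CommutativeMonoid)
open import Data.Bool using (Bool; true; false; _∧_; if_then_else_)
open import Data.Bool.Properties using (∧-identityʳ; ∧-assoc; ∧-commutativeMonoid; T-≡)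
open import Data.List using (List; []; _∷_; _++_; _∷ʳ_; length; map; concat; concatMap; zipWith; upTo;
  applyUpTo; replicate; reverse; take; filterᵇ)
open import Data.List.Properties using (map-cong; map-cong-local; map-∘; map-upTo; length-++;
  length-upTo; map-++; filter-++; take-[]; reverse-++; unfold-reverse; upTo-∷ʳ; concatMap-++; ++-identityʳ)
open import Data.List.Relation.Unary.All as All using (All; []; _∷_)
open import Data.List.Relation.Unary.All.Properties using (concat⁺; map⁺; applyUpTo⁺₁; applyUpTo⁺₂; filter⁺)
open import Data.Maybe using (just)
open import Data.Nat using (ℕ; zero; suc; z<s; s≤s; z≤n; _+_; _*_; _∸_; _≤_; _<_; _<ᵇ_; _≡ᵇ_)
open import Data.Nat.ListAction using (sum)
open import Data.Nat.ListAction.Properties using (sum-++)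
open import Data.Nat.Properties
open import Algebra.Properties.CommutativeSemigroup +-commutativeSemigroup using (interchange)
open import Algebra.Properties.CommutativeSemigroup (CommutativeMonoid.commutativeSemigroup ∧-commutativeMonoid)
  renaming (x∙yz≈y∙xz to ∧-x∙yz≈y∙xz) using ()
open import Data.Product using (Σ; ∃; _×_; _,_)
open import Function using (_∘_; id; const)
open import Function.Bundles using (Equivalence)
open import Relation.Binary.PropositionalEquality
open import Relation.Nullary.Decidable using (T?)

private
  variable
    A B : Set

sum-map-+ : (f g : A → ℕ) (xs : List A) →
  sum (map (λ x → f x + g x) xs) ≡ sum (map f xs) + sum (map g xs)
sum-map-+ f g []       = refl
sum-map-+ f g (x ∷ xs) =
  trans (cong (f x + g x +_) (sum-map-+ f g xs)) (interchange (f x) (g x) _ _)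

sum-map-const : (c : ℕ) (xs : List A) → sum (map (const c) xs) ≡ length xs * c
sum-map-const c []       = refl
sum-map-const c (x ∷ xs) = cong (c +_) (sum-map-const c xs)

sum-map-zero : (xs : List A) → sum (map (const 0) xs) ≡ 0
sum-map-zero xs = trans (sum-map-const 0 xs) (*-zeroʳ (length xs))

sum-map-swap : (H : A → B → ℕ) (xs : List A) (ys : List B) →
  sum (map (λ x → sum (map (H x) ys)) xs) ≡ sum (map (λ y → sum (map (λ x → H x y) xs)) ys)
sum-map-swap H []       ys = sym (sum-map-zero ys)
sum-map-swap H (x ∷ xs) ys =
  trans (cong (sum (map (H x) ys) +_) (sum-map-swap H xs ys))
        (sym (sum-map-+ (H x) (λ y → sum (map (λ x′ → H x′ y) xs)) ys))

applyUpTo-+ : (f : ℕ → A) (m n : ℕ) →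
  applyUpTo f (m + n) ≡ applyUpTo f m ++ applyUpTo (f ∘ (m +_)) n
applyUpTo-+ f zero    n = refl
applyUpTo-+ f (suc m) n = cong (f 0 ∷_) (applyUpTo-+ (f ∘ suc) m n)

applyUpTo-cong : {f g : ℕ → A} → (∀ i → f i ≡ g i) → ∀ n → applyUpTo f n ≡ applyUpTo g n
applyUpTo-cong {f = f} {g} f≗g n =
  trans (sym (map-upTo f n)) (trans (map-cong f≗g (upTo n)) (map-upTo g n))

applyUpTo-const : {f : ℕ → A} {c : A} → (∀ i → f i ≡ c) → ∀ n → applyUpTo f n ≡ replicate n c
applyUpTo-const f≗c zero    = refl
applyUpTo-const f≗c (suc n) = cong₂ _∷_ (f≗c 0) (applyUpTo-const (f≗c ∘ suc) n)

dropLast-applyUpTo : (f : ℕ → ℕ) (n : ℕ) → dropLast (applyUpTo f (suc n)) ≡ applyUpTo f n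
dropLast-applyUpTo f zero    = refl
dropLast-applyUpTo f (suc n) = cong (f 0 ∷_) (dropLast-applyUpTo (f ∘ suc) n)

nth-++-right : {P : A → Set} (xs : List A) {ys : List A} {i : ℕ} → All P ys →
  length xs ≤ i → i < length xs + length ys → ∃ λ y → nth i (xs ++ ys) ≡ just y × P y
nth-++-right []       {y ∷ ys} {zero}  (py ∷ _)   _           _          = y , refl , py
nth-++-right []       {y ∷ ys} {suc i} (_ ∷ pys)  _           (s≤s i<ys) = nth-++-right [] pys z≤n i<ys
nth-++-right (x ∷ xs) {ys}     {suc i} pys        (s≤s xs≤i) (s≤s i<)   = nth-++-right xs pys xs≤i i<

count : (A → Bool) → List A → ℕ
count p xs = length (filterᵇ p xs)

count-∷ : (p : A → Bool) (x : A) (xs : List A) →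
  count p (x ∷ xs) ≡ (if p x then 1 else 0) + count p xs
count-∷ p x xs with p x
... | true  = refl
... | false = refl

count-++ : (p : A → Bool) (xs ys : List A) → count p (xs ++ ys) ≡ count p xs + count p ys
count-++ p xs ys = trans (cong length (filter-++ (T? ∘ p) xs ys)) (length-++ (filterᵇ p xs))

count-concat : (p : A → Bool) (xss : List (List A)) → count p (concat xss) ≡ sum (map (count p) xss)
count-concat p []         = refl
count-concat p (xs ∷ xss) =
  trans (count-++ p xs (concat xss)) (cong (count p xs +_) (count-concat p xss))

count-map : (p : B → Bool) (f : A → B) (xs : List A) → count p (map f xs) ≡ count (p ∘ f) xs
count-map p f []       = refl
count-map p f (x ∷ xs) with p (f x)
... | true  = cong suc (count-map p f xs)
... | false = count-map p f xs

count-cong : {p q : A → Bool} → (∀ x → p x ≡ q x) → ∀ xs → count p xs ≡ count q xs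
count-cong         p≗q []       = refl
count-cong {p = p} {q} p≗q (x ∷ xs) =
  trans (count-∷ p x xs)
        (trans (cong₂ (λ b n → (if b then 1 else 0) + n) (p≗q x) (count-cong p≗q xs))
               (sym (count-∷ q x xs)))

count-none : {p : A → Bool} → (∀ x → p x ≡ false) → ∀ xs → count p xs ≡ 0
count-none         p≗false []       = refl
count-none {p = p} p≗false (x ∷ xs) =
  trans (count-∷ p x xs) (cong₂ (λ b n → (if b then 1 else 0) + n) (p≗false x) (count-none p≗false xs))

countWords : ℕ → (List ℕ → Bool) → ℕ → ℕ
countWords b p L = count p (words b L)

countWords-byHead : ∀ b p L →
  countWords b p (suc L) ≡ sum (map (λ d → countWords b (p ∘ (d ∷_)) L) (upTo b))
countWords-byHead b p L = begin
  count p (concat (map rows (upTo b)))     ≡⟨ count-concat p (map rows (upTo b)) ⟩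
  sum (map (count p) (map rows (upTo b)))  ≡⟨ cong sum (map-∘ (upTo b)) ⟨
  sum (map (count p ∘ rows) (upTo b))      ≡⟨ cong sum (map-cong (λ d → count-map p (d ∷_) (words b L)) (upTo b)) ⟩
  sum (map (λ d → countWords b (p ∘ (d ∷_)) L) (upTo b)) ∎
  where
  open ≡-Reasoning
  rows : ℕ → List (List ℕ)
  rows d = map (d ∷_) (words b L)

countWords-byLast : ∀ b p L →
  countWords b p (suc L) ≡ sum (map (λ d → countWords b (λ w → p (w ∷ʳ d)) L) (upTo b))
countWords-byLast b p zero    =
  trans (countWords-byHead b p zero)
        (cong sum (map-cong (λ d → trans (count-∷ (p ∘ (d ∷_)) [] [])
                                           (sym (count-∷ (λ w → p (w ∷ʳ d)) [] []))) (upTo b)))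
countWords-byLast b p (suc L) = begin
  countWords b p (suc (suc L))
    ≡⟨ countWords-byHead b p (suc L) ⟩
  sum (map (λ d → countWords b (λ w → p (d ∷ w)) (suc L)) (upTo b))
    ≡⟨ cong sum (map-cong (λ d → countWords-byLast b (λ w → p (d ∷ w)) L) (upTo b)) ⟩
  sum (map (λ d → sum (map (λ e → countWords b (λ w → p (d ∷ w ∷ʳ e)) L) (upTo b))) (upTo b))
    ≡⟨ sum-map-swap (λ d e → countWords b (λ w → p (d ∷ w ∷ʳ e)) L) (upTo b) (upTo b) ⟩
  sum (map (λ e → sum (map (λ d → countWords b (λ w → p (d ∷ w ∷ʳ e)) L) (upTo b))) (upTo b))
    ≡⟨ cong sum (map-cong (λ e → countWords-byHead b (λ w → p (w ∷ʳ e)) L) (upTo b)) ⟨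
  sum (map (λ e → countWords b (λ w → p (w ∷ʳ e)) (suc L)) (upTo b)) ∎
  where open ≡-Reasoning

words-length : ∀ b L → All (λ w → length w ≡ L) (words b L)
words-length b zero    = refl ∷ []
words-length b (suc L) =
  concat⁺ (map⁺ (applyUpTo⁺₂ _ b (λ d → map⁺ (All.map (cong suc) (words-length b L)))))

validUpToLength-suc : ∀ ls n → validUpToLength ls (suc n) ≡ validUpToLength ls n ++ validOfLength ls (suc n)
validUpToLength-suc ls n = begin
  concatMap f (upTo (suc n))          ≡⟨ cong (concatMap f) (upTo-∷ʳ n) ⟨
  concatMap f (upTo n ∷ʳ n)           ≡⟨ concatMap-++ f (upTo n) (n ∷ []) ⟩
  concatMap f (upTo n) ++ (f n ++ []) ≡⟨ cong (concatMap f (upTo n) ++_) (++-identityʳ (f n)) ⟩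
  concatMap f (upTo n) ++ f n         ∎
  where
  open ≡-Reasoning
  f : ℕ → List (List ℕ)
  f L = validOfLength ls (suc L)

reverse-∷ʳ : (w : List A) (d : A) → reverse (w ∷ʳ d) ≡ d ∷ reverse w
reverse-∷ʳ w d = reverse-++ w (d ∷ [])

blockOK-∷ : ∀ ls d r → blockOK ls (d ∷ r) ≡ allZero (take (mu ls d ∸ 1) r) ∧ blockOK ls r
blockOK-∷ ls d []       rewrite take-[] {A = ℕ} (mu ls d ∸ 1) = refl
blockOK-∷ ls d (h ∷ hs) = refl

allZero-take-∷ʳ-0 : ∀ m xs → allZero (take m (xs ∷ʳ 0)) ≡ allZero (take m xs)
allZero-take-∷ʳ-0 zero    xs       = refl
allZero-take-∷ʳ-0 (suc m) []       rewrite take-[] {A = ℕ} m = refl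
allZero-take-∷ʳ-0 (suc m) (x ∷ xs) = cong ((x ≡ᵇ 0) ∧_) (allZero-take-∷ʳ-0 m xs)

blockOK-∷ʳ-0 : ∀ ls r → blockOK ls (r ∷ʳ 0) ≡ blockOK ls r
blockOK-∷ʳ-0 ls []      = refl
blockOK-∷ʳ-0 ls (d ∷ r) = begin
  blockOK ls (d ∷ r ∷ʳ 0)
    ≡⟨ blockOK-∷ ls d (r ∷ʳ 0) ⟩
  allZero (take (mu ls d ∸ 1) (r ∷ʳ 0)) ∧ blockOK ls (r ∷ʳ 0)
    ≡⟨ cong₂ _∧_ (allZero-take-∷ʳ-0 (mu ls d ∸ 1) r) (blockOK-∷ʳ-0 ls r) ⟩
  allZero (take (mu ls d ∸ 1) r) ∧ blockOK ls r
    ≡⟨ blockOK-∷ ls d r ⟨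
  blockOK ls (d ∷ r) ∎
  where open ≡-Reasoning

digitsOK-∷ʳ : ∀ ls w d → digitsOK ls (w ∷ʳ d) ≡ digitsOK ls w ∧ (d <ᵇ bigΛ ls)
digitsOK-∷ʳ ls []      d = ∧-identityʳ (d <ᵇ bigΛ ls)
digitsOK-∷ʳ ls (x ∷ w) d =
  trans (cong ((x <ᵇ bigΛ ls) ∧_) (digitsOK-∷ʳ ls w d)) (sym (∧-assoc (x <ᵇ bigΛ ls) _ _))

-- muGo ℓ xs acc j scans xs = [λ_j, λ_{j+1}, …] with acc = Λ_{j-1}; the digits ℓ with μ_ℓ = j
-- form the block Λ_{j-1} ≤ ℓ < Λ_j of length λ_j.

muGo-inBlock : ∀ {ℓ x} xs acc j → ℓ < x → muGo (acc + ℓ) (x ∷ xs) acc j ≡ j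
muGo-inBlock {ℓ} {x} xs acc j ℓ<x
  rewrite Equivalence.to T-≡ (<⇒<ᵇ (+-monoʳ-< acc ℓ<x)) = refl

muGo-pastBlock : ∀ x xs acc j e →
  muGo (acc + (x + e)) (x ∷ xs) acc j ≡ muGo (acc + x + e) xs (acc + x) (suc j)
muGo-pastBlock x xs acc j e rewrite sym (+-assoc acc x e) =
  cong (if_then j else muGo (acc + x + e) xs (acc + x) (suc j)) (m+n<ᵇm (acc + x) e)
  where
  m+n<ᵇm : ∀ m n → (m + n <ᵇ m) ≡ false
  m+n<ᵇm zero    n = refl
  m+n<ᵇm (suc m) n = m+n<ᵇm m n

sum-muGo : (g : ℕ → ℕ) (xs : List ℕ) (acc j : ℕ) →
  sum (map (λ ℓ → g (muGo (acc + ℓ) xs acc j)) (upTo (sum xs)))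
    ≡ sum (zipWith _*_ xs (applyUpTo (λ i → g (j + i)) (length xs)))
sum-muGo g []       acc j = refl
sum-muGo g (x ∷ xs) acc j = begin
  sum (map F (upTo (x + sum xs)))
    ≡⟨ cong (sum ∘ map F) (applyUpTo-+ id x (sum xs)) ⟩
  sum (map F (upTo x ++ applyUpTo (x +_) (sum xs)))
    ≡⟨ cong sum (map-++ F (upTo x) _) ⟩
  sum (map F (upTo x) ++ map F (applyUpTo (x +_) (sum xs)))
    ≡⟨ sum-++ (map F (upTo x)) _ ⟩
  sum (map F (upTo x)) + sum (map F (applyUpTo (x +_) (sum xs)))
    ≡⟨ cong₂ _+_ firstBlock laterBlocks ⟩
  x * g (j + 0) + sum (zipWith _*_ xs (applyUpTo (λ i → g (j + suc i)) (length xs))) ∎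
  where
  open ≡-Reasoning
  F : ℕ → ℕ
  F ℓ = g (muGo (acc + ℓ) (x ∷ xs) acc j)

  firstBlock : sum (map F (upTo x)) ≡ x * g (j + 0)
  firstBlock = begin
    sum (map F (upTo x))
      ≡⟨ cong sum (map-cong-local (applyUpTo⁺₁ id x
           (λ ℓ<x → cong g (trans (muGo-inBlock xs acc j ℓ<x) (sym (+-identityʳ j)))))) ⟩
    sum (map (const (g (j + 0))) (upTo x))  ≡⟨ sum-map-const (g (j + 0)) (upTo x) ⟩
    length (upTo x) * g (j + 0)             ≡⟨ cong (_* g (j + 0)) (length-upTo x) ⟩
    x * g (j + 0)                           ∎

  laterBlocks : sum (map F (applyUpTo (x +_) (sum xs)))
              ≡ sum (zipWith _*_ xs (applyUpTo (λ i → g (j + suc i)) (length xs)))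
  laterBlocks = begin
    sum (map F (applyUpTo (x +_) (sum xs)))
      ≡⟨ cong (sum ∘ map F) (map-upTo (x +_) (sum xs)) ⟨
    sum (map F (map (x +_) (upTo (sum xs))))
      ≡⟨ cong sum (map-∘ (upTo (sum xs))) ⟨
    sum (map (F ∘ (x +_)) (upTo (sum xs)))
      ≡⟨ cong sum (map-cong (cong g ∘ muGo-pastBlock x xs acc j) (upTo (sum xs))) ⟩
    sum (map (λ e → g (muGo (acc + x + e) xs (acc + x) (suc j))) (upTo (sum xs)))
      ≡⟨ sum-muGo g xs (acc + x) (suc j) ⟩
    sum (zipWith _*_ xs (applyUpTo (λ i → g (suc j + i)) (length xs)))
      ≡⟨ cong (sum ∘ zipWith _*_ xs) (applyUpTo-cong (cong g ∘ sym ∘ +-suc j) (length xs)) ⟩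
    sum (zipWith _*_ xs (applyUpTo (λ i → g (j + suc i)) (length xs))) ∎

module AdmissibleWords (l : ℕ) (rest : List ℕ) where

  -- λ₁ = suc l ≥ 1 is built into the shape, giving Λ ≥ 1 and μ₀ = 1 by computation.
  ls : List ℕ
  ls = suc l ∷ rest

  admissible : List ℕ → Bool
  admissible w = digitsOK ls w ∧ blockOK ls (reverse w)

  #admissible : ℕ → ℕ
  #admissible = countWords (bigΛ ls) admissible

  admissible-∷ʳ : ∀ {d} → d < bigΛ ls → ∀ w →
    admissible (w ∷ʳ d) ≡ allZero (take (mu ls d ∸ 1) (reverse w)) ∧ admissible w
  admissible-∷ʳ {d} d<Λ w = begin
    digitsOK ls (w ∷ʳ d) ∧ blockOK ls (reverse (w ∷ʳ d))
      ≡⟨ cong₂ _∧_ (digitsOK-∷ʳ ls w d) (cong (blockOK ls) (reverse-∷ʳ w d)) ⟩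
    (digitsOK ls w ∧ (d <ᵇ bigΛ ls)) ∧ blockOK ls (d ∷ reverse w)
      ≡⟨ cong₂ _∧_ (cong (digitsOK ls w ∧_) (Equivalence.to T-≡ (<⇒<ᵇ d<Λ))) (blockOK-∷ ls d (reverse w)) ⟩
    (digitsOK ls w ∧ true) ∧ (zeros ∧ blockOK ls (reverse w))
      ≡⟨ cong (_∧ (zeros ∧ blockOK ls (reverse w))) (∧-identityʳ (digitsOK ls w)) ⟩
    digitsOK ls w ∧ (zeros ∧ blockOK ls (reverse w))
      ≡⟨ ∧-x∙yz≈y∙xz (digitsOK ls w) zeros (blockOK ls (reverse w)) ⟩
    zeros ∧ admissible w ∎
    where
    open ≡-Reasoning
    zeros : Bool
    zeros = allZero (take (mu ls d ∸ 1) (reverse w))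

  admissible-0∷ : ∀ w → admissible (0 ∷ w) ≡ admissible w
  admissible-0∷ w = cong (digitsOK ls w ∧_)
    (trans (cong (blockOK ls) (unfold-reverse 0 w)) (blockOK-∷ʳ-0 ls (reverse w)))

  admissibleWithZeroTail : ℕ → List ℕ → Bool
  admissibleWithZeroTail m w = allZero (take m (reverse w)) ∧ admissible w

  #admissibleWithZeroTail : ℕ → ℕ → ℕ
  #admissibleWithZeroTail m = countWords (bigΛ ls) (admissibleWithZeroTail m)

  #admissibleWithZeroTail-suc : ∀ m n →
    #admissibleWithZeroTail (suc m) (suc n) ≡ #admissibleWithZeroTail m n
  #admissibleWithZeroTail-suc m n = begin
    #admissibleWithZeroTail (suc m) (suc n)
      ≡⟨ countWords-byLast (bigΛ ls) (admissibleWithZeroTail (suc m)) n ⟩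
    byLast 0 + sum (map byLast (applyUpTo suc (l + sum rest)))
      ≡⟨ cong₂ _+_ (count-cong lastZero (words (bigΛ ls) n))
           (trans (cong sum (map-cong-local {f = byLast} (applyUpTo⁺₂ suc (l + sum rest)
                    (λ d → count-none (lastNonzero d) (words (bigΛ ls) n)))))
                  (sum-map-zero (applyUpTo suc (l + sum rest)))) ⟩
    #admissibleWithZeroTail m n + 0
      ≡⟨ +-identityʳ _ ⟩
    #admissibleWithZeroTail m n ∎
    where
    open ≡-Reasoning
    byLast : ℕ → ℕ
    byLast d = countWords (bigΛ ls) (λ w → admissibleWithZeroTail (suc m) (w ∷ʳ d)) n
    lastZero : ∀ w → admissibleWithZeroTail (suc m) (w ∷ʳ 0) ≡ admissibleWithZeroTail m w
    lastZero w = cong₂ _∧_ (cong (allZero ∘ take (suc m)) (reverse-∷ʳ w 0)) (admissible-∷ʳ z<s w)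
    lastNonzero : ∀ d w → admissibleWithZeroTail (suc m) (w ∷ʳ suc d) ≡ false
    lastNonzero d w = cong (λ r → allZero (take (suc m) r) ∧ admissible (w ∷ʳ suc d)) (reverse-∷ʳ w (suc d))

  #admissibleWithZeroTail≡ : ∀ m n → #admissibleWithZeroTail m n ≡ #admissible (n ∸ m)
  #admissibleWithZeroTail≡ zero    n       = refl
  #admissibleWithZeroTail≡ (suc m) zero    = refl
  #admissibleWithZeroTail≡ (suc m) (suc n) =
    trans (#admissibleWithZeroTail-suc m n) (#admissibleWithZeroTail≡ m n)

  #admissible-byLastDigit : ∀ n →
    #admissible (suc n) ≡ sum (map (λ ℓ → #admissible (n ∸ (mu ls ℓ ∸ 1))) (upTo (bigΛ ls)))
  #admissible-byLastDigit n =
    trans (countWords-byLast (bigΛ ls) admissible n)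
          (cong sum (map-cong-local (applyUpTo⁺₁ id (bigΛ ls) λ {ℓ} ℓ<Λ →
             trans (count-cong (admissible-∷ʳ ℓ<Λ) (words (bigΛ ls) n))
                   (#admissibleWithZeroTail≡ (mu ls ℓ ∸ 1) n))))

  -- Truncated subtraction n ∸ i realises the convention a_m = 1 for m ≤ 0.
  #admissible-recurrence : ∀ n →
    #admissible (suc n) ≡ sum (zipWith _*_ ls (applyUpTo (λ i → #admissible (n ∸ i)) (length ls)))
  #admissible-recurrence n =
    trans (#admissible-byLastDigit n) (sum-muGo (λ j → #admissible (n ∸ (j ∸ 1))) ls 0 1)

  hist≡window : ∀ n → hist ls n ≡ applyUpTo (λ i → #admissible (n ∸ i)) (length ls)
  hist≡window zero    = sym (applyUpTo-const (λ i → cong #admissible (0∸n≡0 i)) (length ls))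
  hist≡window (suc n) = begin
    sum (zipWith _*_ ls (hist ls n)) ∷ dropLast (hist ls n)
      ≡⟨ cong (λ h → sum (zipWith _*_ ls h) ∷ dropLast h) (hist≡window n) ⟩
    sum (zipWith _*_ ls (window n)) ∷ dropLast (window n)
      ≡⟨ cong₂ _∷_ (sym (#admissible-recurrence n))
                   (dropLast-applyUpTo (λ i → #admissible (n ∸ i)) (length rest)) ⟩
    window (suc n) ∎
    where
    open ≡-Reasoning
    window : ℕ → List ℕ
    window m = applyUpTo (λ i → #admissible (m ∸ i)) (length ls)

  seqA≡#admissible : ∀ n → seqA ls n ≡ #admissible n
  seqA≡#admissible n = cong headOr1 (hist≡window n)

  #valid : ℕ → ℕ
  #valid = countWords (bigΛ ls) (validᵇ ls)

  #admissible-byLeadingDigit : ∀ L → #admissible (suc L) ≡ #admissible L + #valid (suc L)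
  #admissible-byLeadingDigit L = begin
    #admissible (suc L)
      ≡⟨ countWords-byHead (bigΛ ls) admissible L ⟩
    byHead admissible 0 + sum (map (byHead admissible) (applyUpTo suc (l + sum rest)))
      ≡⟨ cong₂ _+_ (count-cong admissible-0∷ (words (bigΛ ls) L))
                   (cong sum (map-cong-local (applyUpTo⁺₂ suc (l + sum rest) (λ _ → refl)))) ⟩
    #admissible L + sum (map (byHead (validᵇ ls)) (applyUpTo suc (l + sum rest)))
      ≡⟨ cong (#admissible L +_) validByHead ⟨
    #admissible L + #valid (suc L) ∎
    where
    open ≡-Reasoning
    byHead : (List ℕ → Bool) → ℕ → ℕ
    byHead p d = countWords (bigΛ ls) (p ∘ (d ∷_)) L
    validByHead : #valid (suc L) ≡ sum (map (byHead (validᵇ ls)) (applyUpTo suc (l + sum rest)))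
    validByHead = trans (countWords-byHead (bigΛ ls) (validᵇ ls) L)
                        (cong (_+ sum (map (byHead (validᵇ ls)) (applyUpTo suc (l + sum rest))))
                              (count-none (λ _ → refl) (words (bigΛ ls) L)))

  length-validUpToLength : ∀ n → suc (length (validUpToLength ls n)) ≡ #admissible n
  length-validUpToLength zero    = refl
  length-validUpToLength (suc n) = begin
    suc (length (validUpToLength ls (suc n)))
      ≡⟨ cong (suc ∘ length) (validUpToLength-suc ls n) ⟩
    suc (length (validUpToLength ls n ++ validOfLength ls (suc n)))
      ≡⟨ cong suc (length-++ (validUpToLength ls n)) ⟩
    suc (length (validUpToLength ls n)) + #valid (suc n)
      ≡⟨ cong (_+ #valid (suc n)) (length-validUpToLength n) ⟩
    #admissible n + #valid (suc n)
      ≡⟨ #admissible-byLeadingDigit n ⟨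
    #admissible (suc n) ∎
    where open ≡-Reasoning

corollary4p4 : (ls : List ℕ) → Admissible ls → (N t : ℕ) → 1 ≤ N →
    seqA ls t ≤ N → N < seqA ls (suc t) →
    Σ (List ℕ) (λ ds → IsZeckendorfRep ls N ds × length ds ≡ suc t)
corollary4p4 _ record { l₁ = suc l ; rest = rest ; shape = refl } (suc N) t _ a[t]≤N N<a[t+1] =
  let ds , nth≡ds , length≡ = inLongerBlock
  in  ds , (suc t , trans (cong (nth N) (validUpToLength-suc ls t)) nth≡ds) , length≡
  where
  open AdmissibleWords l rest
  shorter : List (List ℕ)
  shorter = validUpToLength ls t

  a[t]≡ : seqA ls t ≡ suc (length shorter)
  a[t]≡ = trans (seqA≡#admissible t) (sym (length-validUpToLength t))

  a[t+1]≡ : seqA ls (suc t) ≡ suc (length shorter + #valid (suc t))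
  a[t+1]≡ = trans (seqA≡#admissible (suc t))
    (trans (#admissible-byLeadingDigit t) (cong (_+ #valid (suc t)) (sym (length-validUpToLength t))))

  inLongerBlock : ∃ λ ds → nth N (shorter ++ validOfLength ls (suc t)) ≡ just ds × length ds ≡ suc t
  inLongerBlock = nth-++-right shorter (filter⁺ (T? ∘ validᵇ ls) (words-length (bigΛ ls) (suc t)))
    (≤-pred (subst (_≤ suc N) a[t]≡ a[t]≤N)) (≤-pred (subst (suc N <_) a[t+1]≡ N<a[t+1]))
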